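{- Let $R$ be a set of $8$ pairwise orthogonal positive roots of $\Phi$ (type $E_8$) with $\theta\notin R$, let $H\in D_6(R)$, let $\Xi=\mathrm{Span}(H)\cap\Phi$, and suppose $|H\cap U_1|=2$ and $|H\cap U_0|=4$. Identify $\Xi$ with the standard $D_6$ root system $\{\pm\varepsilon_i\pm\varepsilon_j:1\le i<j\le6\}$ so that $\Xi\cap\Phi_+$ corresponds to $\{\varepsilon_i\pm\varepsilon_j:i<j\}$ (with simple roots $\varepsilon_1-\varepsilon_2,\dots,\varepsilon_5-\varepsilon_6,\varepsilon_5+\varepsilon_6$). Then: (i) $\theta\notin\Xi$. (ii) The highest root $\psi=\varepsilon_1+\varepsilon_2$ of $\Xi$ has $8$-height $1$. (iii) The simple root $\varepsilon_1-\varepsilon_2$ of $\Xi$ has $8$-height $1$, and the other simple roots of $\Xi$ have $8$-height $0$. (iv) A root $\gamma\in\Xi\cap\Phi_+$ has $8$-height $1$ if $\gamma=\varepsilon_1\pm\varepsilon_i$ for some $i>1$, and $8$-height $0$ otherwise.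
   Context: $\Phi$ is the root system of type $E_8$ with simple roots $\alpha_1,\dots,\alpha_8$ labelled so that $\alpha_1,\alpha_3,\alpha_4,\dots,\alpha_8$ form a path in this order and $\alpha_2$ is joined only to $\alpha_4$; the $8$-height of a root is its $\alpha_8$-coefficient; $U_i$ is the set of positive roots of $8$-height $i$; $\theta$ is the highest root. $D_6(R)=\{H\subseteq R:|H|=6,\ \mathrm{Span}(H)\cap\Phi\text{ is a subsystem of type }D_6\}$. -}

module Defs where

open import Data.Nat using (ℕ; zero; suc)
open import Data.Fin using (Fin; zero; suc; _<_)
open import Data.Fin.Properties using () renaming (_≟_ to _≟F_)
open import Data.Integer using (ℤ; +_)
open import Data.Integer.Properties using () renaming (_≟_ to _≟ℤ_)
open import Data.Rational using (ℚ; 0ℚ; 1ℚ; _+_; _*_; -_; _/_)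
open import Data.Bool using (Bool; true; false)
open import Data.Product using (Σ; ∃; _×_; _,_)
open import Relation.Binary.PropositionalEquality using (_≡_; _≢_)
open import Relation.Nullary using (¬_; yes; no)

-- Simple roots α₁,…,α₈ are indexed by Fin 8: αₖ ↦ index (k-1).
-- Dynkin diagram (Bourbaki): α₁–α₃–α₄–α₅–α₆–α₇–α₈ and α₂–α₄.

-- Elements of the root lattice, in coordinates w.r.t. the simple roots.
Lat : Set
Lat = Fin 8 → ℤ

VecQ : Set
VecQ = Fin 8 → ℚ

toQ : Lat → VecQ
toQ v a = v a / 1

2ℚ : ℚ
2ℚ = 1ℚ + 1ℚ

adj : Fin 8 → Fin 8 → Bool
adj zero (suc (suc zero)) = true
adj (suc (suc zero)) zero = true
adj (suc zero) (suc (suc (suc zero))) = true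
adj (suc (suc (suc zero))) (suc zero) = true
adj (suc (suc zero)) (suc (suc (suc zero))) = true
adj (suc (suc (suc zero))) (suc (suc zero)) = true
adj (suc (suc (suc zero))) (suc (suc (suc (suc zero)))) = true
adj (suc (suc (suc (suc zero)))) (suc (suc (suc zero))) = true
adj (suc (suc (suc (suc zero)))) (suc (suc (suc (suc (suc zero))))) = true
adj (suc (suc (suc (suc (suc zero))))) (suc (suc (suc (suc zero)))) = true
adj (suc (suc (suc (suc (suc zero))))) (suc (suc (suc (suc (suc (suc zero)))))) = true
adj (suc (suc (suc (suc (suc (suc zero)))))) (suc (suc (suc (suc (suc zero))))) = true
adj (suc (suc (suc (suc (suc (suc zero)))))) (suc (suc (suc (suc (suc (suc (suc zero))))))) = true
adj (suc (suc (suc (suc (suc (suc (suc zero))))))) (suc (suc (suc (suc (suc (suc zero)))))) = true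
adj _ _ = false

-- Cartan matrix of E₈ = Gram matrix (αₐ,α_b) with (α,α) = 2.
cartan : Fin 8 → Fin 8 → ℚ
cartan a b with a ≟F b
... | yes _ = 2ℚ
... | no _ with adj a b
...   | true = - 1ℚ
...   | false = 0ℚ

sumQ : (n : ℕ) → (Fin n → ℚ) → ℚ
sumQ zero f = 0ℚ
sumQ (suc n) f = f zero + sumQ n (λ k → f (suc k))

form : VecQ → VecQ → ℚ
form v w = sumQ 8 (λ a → sumQ 8 (λ b → v a * (cartan a b * w b)))

-- Φ (type E₈): the lattice vectors of squared length 2 (E₈ is the unique
-- simply-laced root system whose roots are all norm-2 vectors of its root lattice).
IsRoot : Lat → Set
IsRoot v = form (toQ v) (toQ v) ≡ 2ℚ

IsPositive : Lat → Set
IsPositive v = IsRoot v × (∀ a → + 0 Data.Integer.≤ v a)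

θ : Lat
θ zero = + 2
θ (suc zero) = + 3
θ (suc (suc zero)) = + 4
θ (suc (suc (suc zero))) = + 6
θ (suc (suc (suc (suc zero)))) = + 5
θ (suc (suc (suc (suc (suc zero))))) = + 4
θ (suc (suc (suc (suc (suc (suc zero)))))) = + 3
θ (suc (suc (suc (suc (suc (suc (suc zero))))))) = + 2

i8 : Fin 8
i8 = suc (suc (suc (suc (suc (suc (suc zero))))))

ht8 : Lat → ℤ
ht8 v = v i8

ht8Q : VecQ → ℚ
ht8Q v = v i8

_≈_ : VecQ → VecQ → Set
v ≈ w = ∀ a → v a ≡ w a

-- R : a family of 8 pairwise orthogonal positive roots (indexed by Fin 8;
-- orthogonality forces them to be distinct, so this is an 8-element set).
IsOrthPosFamily : (Fin 8 → Lat) → Set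
IsOrthPosFamily R =
  (∀ k → IsPositive (R k)) ×
  (∀ k l → k ≢ l → form (toQ (R k)) (toQ (R l)) ≡ 0ℚ)

ThetaNotIn : (Fin 8 → Lat) → Set
ThetaNotIn R = ∀ k → ¬ (∀ a → R k a ≡ θ a)

-- w ∈ ℚ-span of the vectors vs k (the ℝ-span meets the ℚ-vectors in the ℚ-span)
InSpan : {n : ℕ} → (Fin n → VecQ) → VecQ → Set
InSpan {n} vs w = Σ (Fin n → ℚ) λ c → ∀ a → w a ≡ sumQ n (λ k → c k * vs k a)

-- Ξ = Span(H) ∩ Φ, where H = {R (h k) : k : Fin 6}
InXi : (Fin 8 → Lat) → (Fin 6 → Fin 8) → Lat → Set
InXi R h v = IsRoot v × InSpan (λ k → toQ (R (h k))) (toQ v)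

sgn : Bool → ℚ
sgn true = 1ℚ
sgn false = - 1ℚ

δ : Fin 6 → Fin 6 → ℚ
δ i j with i ≟F j
... | yes _ = 1ℚ
... | no _ = 0ℚ

-- the vector s·εᵢ + t·εⱼ under the identification e (e i = image of ε_{i+1})
comb : (Fin 6 → VecQ) → Fin 6 → Bool → Fin 6 → Bool → VecQ
comb e i s j t a = sgn s * e i a + sgn t * e j a

-- e identifies the set X ⊆ Φ with the standard D₆ root system
-- {±εᵢ±εⱼ : i<j}: the εᵢ are sent to an orthonormal family e i, and the
-- induced linear map sends the D₆ roots exactly onto X.
IsD6Ident : (Lat → Set) → (Fin 6 → VecQ) → Set
IsD6Ident X e =
  (∀ i j → form (e i) (e j) ≡ δ i j) ×
  (∀ i j → i < j → ∀ s t → Σ Lat λ v → X v × (toQ v ≈ comb e i s j t)) ×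
  (∀ v → X v → Σ (Fin 6) λ i → Σ (Fin 6) λ j → i < j × Σ Bool λ s → Σ Bool λ t → toQ v ≈ comb e i s j t)

IsPosD6Ident : (Lat → Set) → (Fin 6 → VecQ) → Set
IsPosD6Ident X e =
  IsD6Ident X e ×
  (∀ i j → i < j → ∀ t → ∀ v → X v → toQ v ≈ comb e i true j t → IsPositive v)

IsTypeD6 : (Lat → Set) → Set
IsTypeD6 X = Σ (Fin 6 → VecQ) λ e → IsD6Ident X e

count : (n : ℕ) → (Fin n → Bool) → ℕ
count zero f = 0
count (suc n) f with f zero
... | true = suc (count n (λ k → f (suc k)))
... | false = count n (λ k → f (suc k))

htIs : ℤ → Lat → Bool
htIs z v with ht8 v ≟ℤ z
... | yes _ = true
... | no _ = false

-- H ∈ D₆(R): H = {R (h k)} with h injective (so |H| = 6) and Span(H)∩Φ of type D₆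
InD6 : (Fin 8 → Lat) → (Fin 6 → Fin 8) → Set
InD6 R h = (∀ k l → h k ≡ h l → k ≡ l) × IsTypeD6 (InXi R h)

-- The 8-height is a linear functional on Span(H). In the orthogonal basis H of roots of
-- norm 2, two of height 1 and four of height 0, its squared norm is ½(1 + 1) = 1; in the
-- orthonormal basis ε₁,…,ε₆ it is Σ xᵢ², where xᵢ is the height of εᵢ. Every positive root
-- εᵢ ± εⱼ (i < j) of Ξ has a natural number xᵢ ± xⱼ as height, i.e. x is a dominant weight
-- of D₆ of norm 1, and the only such weight is ε₁: the heights of ε₁ ± ε₂, ε₃ ± ε₄, ε₅ ± ε₆
-- are naturals whose squares add up to 2, and integrality of the heights of ε₂ − ε₃ and
-- ε₄ − ε₅ leaves only ε₁ ± ε₂ of height 1. Hence the heights of the roots of Ξ are read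
-- off from x = ε₁; they lie in {−1, 0, 1}, whereas θ has height 2.
module Submission where

open import Defs
open import Algebra.Bundles using (CommutativeRing)
open import Data.Bool using (Bool; true; false)
open import Data.Fin using (Fin; zero; suc; _<_; punchIn; #_)
open import Data.Fin.Properties using (all?; punchInᵢ≢i) renaming (_≟_ to _≟F_)
open import Data.Integer as ℤ using (+_)
import Data.Integer.Properties as ℤ
open import Data.List using (List; []; _∷_; foldr; map)
open import Data.List.Relation.Unary.All using (All; []; _∷_)
open import Data.Nat as ℕ using (ℕ; zero; suc; z≤n; s≤s)
import Data.Nat.Coprimality as Coprime
import Data.Nat.Properties as ℕ
open import Data.Product using (Σ; _×_; _,_; proj₁; proj₂)
open import Data.Rational using (ℚ; mkℚ; 0ℚ; 1ℚ; ½; _+_; _*_; -_; _/_; ↥_)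
open import Data.Rational.Properties
  using (_≟_; +-*-commutativeRing; normalize-coprime; /-cong; +-identityˡ; +-identityʳ;
         *-identityˡ; *-identityʳ; *-zeroʳ; *-comm; *-assoc)
open import Data.Rational.Solver using (module +-*-Solver)
open import Data.Unit using (tt)
open import Relation.Binary.PropositionalEquality
open import Relation.Nullary using (¬_; yes; no; contradiction)
open import Relation.Nullary.Decidable using (toWitness)

open CommutativeRing +-*-commutativeRing using (semiring)
open import Algebra.Properties.Semiring.Sum semiring
  using (sum; sum-cong-≗; sum-remove; sum-replicate-zero; ∑-comm; ∑-distrib-+; *-distribˡ-sum; *-distribʳ-sum)
open +-*-Solver using (solve; _:=_; con; _:+_; _:*_; Polynomial)

-- Given by its normal form rather than as + n / 1, so that fromℕ m ≡ fromℕ n unifies m with n.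
fromℕ : ℕ → ℚ
fromℕ n = mkℚ (+ n) 0 (Coprime.sym (Coprime.1-coprimeTo n))

n/1≡fromℕ : ∀ n → + n / 1 ≡ fromℕ n
n/1≡fromℕ n = normalize-coprime (Coprime.sym (Coprime.1-coprimeTo n))

fromℕ-injective : ∀ {m n} → fromℕ m ≡ fromℕ n → m ≡ n
fromℕ-injective eq = ℤ.+-injective (cong ↥_ eq)

fromℕ-homo-+ : ∀ m n → fromℕ (m ℕ.+ n) ≡ fromℕ m + fromℕ n
fromℕ-homo-+ m n = trans (sym (n/1≡fromℕ (m ℕ.+ n)))
  (/-cong (sym (cong₂ ℤ._+_ (ℤ.*-identityʳ (+ m)) (ℤ.*-identityʳ (+ n)))) refl)

fromℕ-homo-* : ∀ m n → fromℕ (m ℕ.* n) ≡ fromℕ m * fromℕ n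
fromℕ-homo-* m n = trans (sym (n/1≡fromℕ (m ℕ.* n))) (/-cong (ℤ.pos-* m n) refl)

sumQ≡sum : ∀ n (f : Fin n → ℚ) → sumQ n f ≡ sum f
sumQ≡sum zero    f = refl
sumQ≡sum (suc n) f = cong (_+_ (f zero)) (sumQ≡sum n (λ k → f (suc k)))

sum-vanishing-off : ∀ {n} (f : Fin (suc n) → ℚ) i → (∀ k → k ≢ i → f k ≡ 0ℚ) → sum f ≡ f i
sum-vanishing-off {n} f i vanishing = begin
  sum f                              ≡⟨ sum-remove {i = i} f ⟩
  f i + sum (λ k → f (punchIn i k))  ≡⟨ cong (_+_ (f i)) (sum-cong-≗ {n} (λ k → vanishing _ (punchInᵢ≢i i k))) ⟩
  f i + sum {n} (λ _ → 0ℚ)           ≡⟨ cong (_+_ (f i)) (sum-replicate-zero n) ⟩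
  f i + 0ℚ                           ≡⟨ +-identityʳ (f i) ⟩
  f i                                ∎
  where open ≡-Reasoning

δ-refl : ∀ k → δ k k ≡ 1ℚ
δ-refl k with k ≟F k
... | yes _   = refl
... | no k≢k = contradiction refl k≢k

δ-≢ : ∀ {k l} → k ≢ l → δ k l ≡ 0ℚ
δ-≢ {k} {l} k≢l with k ≟F l
... | yes k≡l = contradiction k≡l k≢l
... | no _    = refl

sumQ-δ : ∀ (f : Fin 6 → ℚ) l → sumQ 6 (λ k → f k * δ k l) ≡ f l
sumQ-δ f l =
  trans (sum-vanishing-off _ l (λ k k≢l → trans (cong (f k *_) (δ-≢ k≢l)) (*-zeroʳ (f k))))
        (trans (cong (f l *_) (δ-refl l)) (*-identityʳ (f l)))

-- The invariant form

cartan-sym : ∀ a b → cartan a b ≡ cartan b a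
cartan-sym = toWitness {a? = all? λ a → all? λ b → cartan a b ≟ cartan b a} tt

cartan· : VecQ → VecQ
cartan· u a = sumQ 8 (λ b → cartan a b * u b)

form≡sum-cartan· : ∀ v u → form v u ≡ sumQ 8 (λ a → v a * cartan· u a)
form≡sum-cartan· v u = sum-cong-≗ {8} (λ a → sym (*-distribˡ-sum (v a) (λ b → cartan a b * u b)))

form-congˡ : ∀ {v w} u → v ≈ w → form v u ≡ form w u
form-congˡ u v≈w = sum-cong-≗ {8} (λ a → cong (λ y → sumQ 8 (λ b → y * (cartan a b * u b))) (v≈w a))

form-sym : ∀ v u → form v u ≡ form u v
form-sym v u = trans (∑-comm (λ a b → v a * (cartan a b * u b)))
                     (sum-cong-≗ {8} λ b → sum-cong-≗ {8} λ a → swap a b)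
  where
  reorder : ∀ x c y → x * (c * y) ≡ y * (c * x)
  reorder = solve 3 (λ x c y → x :* (c :* y) := y :* (c :* x)) refl
  swap : ∀ a b → v a * (cartan a b * u b) ≡ u b * (cartan b a * v a)
  swap a b rewrite cartan-sym a b = reorder (v a) (cartan b a) (u b)

lincomb : ∀ {n} → (Fin n → ℚ) → (Fin n → VecQ) → VecQ
lincomb {n} c vs a = sumQ n (λ k → c k * vs k a)

form-lincombˡ : ∀ {n} (c : Fin n → ℚ) vs u →
  form (lincomb c vs) u ≡ sumQ n (λ k → c k * form (vs k) u)
form-lincombˡ {n} c vs u = begin
  form (lincomb c vs) u                               ≡⟨ form≡sum-cartan· (lincomb c vs) u ⟩
  sum {8} (λ a → lincomb c vs a * Cu a)               ≡⟨ sum-cong-≗ {8} (λ a → cong (_* Cu a) (sumQ≡sum n (λ k → c k * vs k a))) ⟩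
  sum {8} (λ a → sum {n} (λ k → c k * vs k a) * Cu a) ≡⟨ sum-cong-≗ {8} (λ a → *-distribʳ-sum (Cu a) (λ k → c k * vs k a)) ⟩
  sum {8} (λ a → sum {n} (λ k → c k * vs k a * Cu a)) ≡⟨ ∑-comm (λ a k → c k * vs k a * Cu a) ⟩
  sum {n} (λ k → sum {8} (λ a → c k * vs k a * Cu a)) ≡⟨ sum-cong-≗ {n} pull-out ⟩
  sum {n} (λ k → c k * sum {8} (λ a → vs k a * Cu a)) ≡⟨ sum-cong-≗ {n} (λ k → cong (c k *_) (form≡sum-cartan· (vs k) u)) ⟨
  sum {n} (λ k → c k * form (vs k) u)                 ≡⟨ sumQ≡sum n (λ k → c k * form (vs k) u) ⟨
  sumQ n (λ k → c k * form (vs k) u)                  ∎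
  where
  open ≡-Reasoning
  Cu : VecQ
  Cu = cartan· u
  pull-out : ∀ k → sum {8} (λ a → c k * vs k a * Cu a) ≡ c k * sum {8} (λ a → vs k a * Cu a)
  pull-out k = trans (sum-cong-≗ {8} (λ a → *-assoc (c k) (vs k a) (Cu a)))
                     (sym (*-distribˡ-sum (c k) (λ a → vs k a * Cu a)))

lincomb-linear : ∀ {n} (p q : ℚ) (c d : Fin n → ℚ) vs a →
  lincomb (λ k → p * c k + q * d k) vs a ≡ p * lincomb c vs a + q * lincomb d vs a
lincomb-linear {n} p q c d vs a = begin
  sumQ n (λ k → (p * c k + q * d k) * vs k a)             ≡⟨ sumQ≡sum n _ ⟩
  sum {n} (λ k → (p * c k + q * d k) * vs k a)            ≡⟨ sum-cong-≗ {n} (λ k → distrib p q (c k) (d k) (vs k a)) ⟩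
  sum {n} (λ k → p * (c k * vs k a) + q * (d k * vs k a)) ≡⟨ ∑-distrib-+ (λ k → p * (c k * vs k a)) (λ k → q * (d k * vs k a)) ⟩
  sum {n} (λ k → p * (c k * vs k a)) + sum {n} (λ k → q * (d k * vs k a))
    ≡⟨ cong₂ _+_ (sym (*-distribˡ-sum p (λ k → c k * vs k a))) (sym (*-distribˡ-sum q (λ k → d k * vs k a))) ⟩
  p * sum {n} (λ k → c k * vs k a) + q * sum {n} (λ k → d k * vs k a)
    ≡⟨ cong₂ (λ y z → p * y + q * z) (sumQ≡sum n _) (sumQ≡sum n _) ⟨
  p * lincomb c vs a + q * lincomb d vs a                 ∎
  where
  open ≡-Reasoning
  distrib : ∀ p q x y v → (p * x + q * y) * v ≡ p * (x * v) + q * (y * v)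
  distrib = solve 5 (λ p q x y v → (p :* x :+ q :* y) :* v := p :* (x :* v) :+ q :* (y :* v)) refl

InSpan-combine : ∀ {n} {vs : Fin n → VecQ} {u u′ w} p q → InSpan vs u → InSpan vs u′ →
  (∀ a → w a ≡ p * u a + q * u′ a) → InSpan vs w
InSpan-combine {vs = vs} p q (c , u≈) (d , u′≈) w≈ =
  (λ k → p * c k + q * d k) ,
  λ a → trans (w≈ a) (trans (cong₂ (λ y z → p * y + q * z) (u≈ a) (u′≈ a)) (sym (lincomb-linear p q c d vs a)))

InSpan-member : ∀ (vs : Fin 6 → VecQ) k → InSpan vs (vs k)
InSpan-member vs k = (λ l → δ l k) ,
  λ a → sym (trans (sum-cong-≗ {6} (λ l → *-comm (δ l k) (vs l a))) (sumQ-δ (λ l → vs l a) k))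

lincomb-represents-coordinate : ∀ (vs : Fin 6 → VecQ) μ → (∀ k l → form (vs k) (vs l) ≡ μ * δ k l) →
  ∀ {a} (c : Fin 6 → ℚ) → (∀ k → c k * μ ≡ vs k a) →
  ∀ {w} → InSpan vs w → form w (lincomb c vs) ≡ w a
lincomb-represents-coordinate vs μ gram {a} c scaled {w} (d , w≈) = begin
  form w P                            ≡⟨ form-congˡ P w≈ ⟩
  form (lincomb d vs) P               ≡⟨ form-lincombˡ d vs P ⟩
  sumQ 6 (λ k → d k * form (vs k) P)  ≡⟨ sum-cong-≗ {6} (λ k → cong (d k *_) (on-basis k)) ⟩
  sumQ 6 (λ k → d k * vs k a)         ≡⟨ w≈ a ⟨
  w a                                 ∎
  where
  open ≡-Reasoning
  P : VecQ
  P = lincomb c vs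
  on-basis : ∀ k → form (vs k) P ≡ vs k a
  on-basis k = begin
    form (vs k) P                           ≡⟨ form-sym (vs k) P ⟩
    form P (vs k)                           ≡⟨ form-lincombˡ c vs (vs k) ⟩
    sumQ 6 (λ l → c l * form (vs l) (vs k)) ≡⟨ sum-cong-≗ {6} (λ l → trans (cong (c l *_) (gram l k)) (sym (*-assoc (c l) μ (δ l k)))) ⟩
    sumQ 6 (λ l → c l * μ * δ l k)          ≡⟨ sumQ-δ (λ l → c l * μ) k ⟩
    c k * μ                                 ≡⟨ scaled k ⟩
    vs k a                                  ∎

-- P and Q represent the a-th coordinate on the common span of the two families, so form Q P
-- is its squared norm, computed once in each family.
sumSq-coordinate-basis-change : ∀ (vs ws : Fin 6 → VecQ) →
  (∀ k l → form (vs k) (vs l) ≡ 2ℚ * δ k l) → (∀ i j → form (ws i) (ws j) ≡ δ i j) →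
  (∀ k → InSpan ws (vs k)) → (∀ i → InSpan vs (ws i)) →
  ∀ a → sumQ 6 (λ i → ws i a * ws i a) ≡ ½ * sumQ 6 (λ k → vs k a * vs k a)
sumSq-coordinate-basis-change vs ws gram-vs gram-ws vs∈ ws∈ a = begin
  sumQ 6 (λ i → ws i a * ws i a)            ≡⟨ sum-cong-≗ {6} (λ i → cong (ws i a *_) (P-represents (ws∈ i))) ⟨
  sumQ 6 (λ i → ws i a * form (ws i) P)     ≡⟨ form-lincombˡ (λ i → ws i a) ws P ⟨
  form Q P                                  ≡⟨ form-sym Q P ⟩
  form P Q                                  ≡⟨ form-lincombˡ (λ k → ½ * vs k a) vs Q ⟩
  sumQ 6 (λ k → ½ * vs k a * form (vs k) Q) ≡⟨ sum-cong-≗ {6} (λ k → trans (cong (½ * vs k a *_) (Q-represents (vs∈ k)))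
                                                                            (*-assoc ½ (vs k a) (vs k a))) ⟩
  sumQ 6 (λ k → ½ * (vs k a * vs k a))      ≡⟨ *-distribˡ-sum ½ (λ k → vs k a * vs k a) ⟨
  ½ * sumQ 6 (λ k → vs k a * vs k a)        ∎
  where
  open ≡-Reasoning
  P Q : VecQ
  P = lincomb (λ k → ½ * vs k a) vs
  Q = lincomb (λ i → ws i a) ws
  half-double : ∀ y → ½ * y * 2ℚ ≡ y
  half-double = solve 1 (λ y → con ½ :* y :* con 2ℚ := y) refl
  P-represents : ∀ {w} → InSpan vs w → form w P ≡ w a
  P-represents = lincomb-represents-coordinate vs 2ℚ gram-vs (λ k → ½ * vs k a) (λ k → half-double (vs k a))
  Q-represents : ∀ {w} → InSpan ws w → form w Q ≡ w a
  Q-represents = lincomb-represents-coordinate ws 1ℚ (λ i j → trans (gram-ws i j) (sym (*-identityˡ (δ i j))))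
                   (λ i → ws i a) (λ i → *-identityʳ (ws i a))

-- Identifications with D₆

-- Spelled as in comb (sgn true rather than 1ℚ), so that comb e i true j t a is definitionally
-- e i a ±[ t ] e j a.
infix 6 _±[_]_
_±[_]_ : ℚ → Bool → ℚ → ℚ
y ±[ t ] z = sgn true * y + sgn t * z

infix 7 _±ᴾ[_]_
_±ᴾ[_]_ : ∀ {n} → Polynomial n → Bool → Polynomial n → Polynomial n
y ±ᴾ[ t ] z = con (sgn true) :* y :+ con (sgn t) :* z

pair-recover : ∀ y z →
  y ≡ ½ * (y ±[ true ] z) + ½ * (y ±[ false ] z) × z ≡ ½ * (y ±[ true ] z) + - ½ * (y ±[ false ] z)
pair-recover y z =
  solve 2 (λ y z → y := con ½ :* (y ±ᴾ[ true ] z) :+ con ½ :* (y ±ᴾ[ false ] z)) refl y z ,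
  solve 2 (λ y z → z := con ½ :* (y ±ᴾ[ true ] z) :+ con (- ½) :* (y ±ᴾ[ false ] z)) refl y z

D6-root∈span-ε : ∀ {X e} → IsD6Ident X e → ∀ v → X v → InSpan e (toQ v)
D6-root∈span-ε {e = e} (_ , _ , classify) v Xv with classify v Xv
... | i , j , _ , s , t , v≈ = InSpan-combine {vs = e} (sgn s) (sgn t) (InSpan-member e i) (InSpan-member e j) v≈

D6-ε-pair∈span : ∀ {X e n} {vs : Fin n → VecQ} → IsD6Ident X e → (∀ v → X v → InSpan vs (toQ v)) →
  ∀ i j → i < j → InSpan vs (e i) × InSpan vs (e j)
D6-ε-pair∈span {e = e} (_ , roots , _) X⊆span i j i<j
  with roots i j i<j true true | roots i j i<j true false
... | v₊ , Xv₊ , v₊≈ | v₋ , Xv₋ , v₋≈ =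
  InSpan-combine ½ ½ (X⊆span v₊ Xv₊) (X⊆span v₋ Xv₋)
    (λ a → trans (proj₁ (pair-recover (e i a) (e j a))) (sym (heights ½ ½ a))) ,
  InSpan-combine ½ (- ½) (X⊆span v₊ Xv₊) (X⊆span v₋ Xv₋)
    (λ a → trans (proj₂ (pair-recover (e i a) (e j a))) (sym (heights ½ (- ½) a)))
  where
  heights : ∀ p q a → p * toQ v₊ a + q * toQ v₋ a ≡ p * (e i a ±[ true ] e j a) + q * (e i a ±[ false ] e j a)
  heights p q a = cong₂ (λ y z → p * y + q * z) (v₊≈ a) (v₋≈ a)

D6-ε∈span : ∀ {X e n} {vs : Fin n → VecQ} → IsD6Ident X e → (∀ v → X v → InSpan vs (toQ v)) →
  ∀ i → InSpan vs (e i)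
D6-ε∈span ident X⊆span zero    = proj₁ (D6-ε-pair∈span ident X⊆span zero (suc zero) (s≤s z≤n))
D6-ε∈span ident X⊆span (suc k) = proj₂ (D6-ε-pair∈span ident X⊆span zero (suc k) (s≤s z≤n))

D6-positive-coordinate-ℕ : ∀ {X e} → IsPosD6Ident X e →
  ∀ i j → i < j → ∀ t a → Σ ℕ λ n → e i a ±[ t ] e j a ≡ fromℕ n
D6-positive-coordinate-ℕ ((_ , roots , _) , positive) i j i<j t a with roots i j i<j true t
... | v , Xv , v≈ =
  ℤ.∣ v a ∣ ,
  trans (sym (v≈ a)) (trans (cong (_/ 1) (sym (ℤ.0≤i⇒+∣i∣≡i (proj₂ (positive i j i<j t v Xv v≈) a)))) (n/1≡fromℕ _))

count-htIs≤ : ∀ n (vs : Fin n → Lat) →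
  count n (λ k → htIs (+ 1) (vs k)) ℕ.+ count n (λ k → htIs (+ 0) (vs k)) ℕ.≤ n
count-htIs≤ zero    vs = z≤n
count-htIs≤ (suc n) vs with vs zero i8 ℤ.≟ + 1 | vs zero i8 ℤ.≟ + 0
... | yes h≡1 | yes h≡0 = contradiction (trans (sym h≡1) h≡0) λ ()
... | yes _   | no _    = s≤s (count-htIs≤ n (λ k → vs (suc k)))
... | no _    | yes _   = subst (ℕ._≤ suc n) (sym (ℕ.+-suc _ _)) (s≤s (count-htIs≤ n (λ k → vs (suc k))))
... | no _    | no _    = ℕ.m≤n⇒m≤1+n (count-htIs≤ n (λ k → vs (suc k)))

sumSq-ht8 : ∀ n (vs : Fin n → Lat) →
  count n (λ k → htIs (+ 1) (vs k)) ℕ.+ count n (λ k → htIs (+ 0) (vs k)) ≡ n →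
  sumQ n (λ k → toQ (vs k) i8 * toQ (vs k) i8) ≡ fromℕ (count n (λ k → htIs (+ 1) (vs k)))
sumSq-ht8 zero    vs _ = refl
sumSq-ht8 (suc n) vs total
  with vs zero i8 ℤ.≟ + 1 | vs zero i8 ℤ.≟ + 0 | count-htIs≤ n (λ k → vs (suc k))
... | yes h≡1 | yes h≡0 | _ = contradiction (trans (sym h≡1) h≡0) λ ()
... | yes h≡1 | no _    | _ rewrite h≡1 =
  trans (cong (_+_ 1ℚ) (sumSq-ht8 n (λ k → vs (suc k)) (ℕ.suc-injective total)))
        (sym (fromℕ-homo-+ 1 (count n (λ k → htIs (+ 1) (vs (suc k))))))
... | no _    | yes h≡0 | _ rewrite h≡0 =
  trans (+-identityˡ _) (sumSq-ht8 n (λ k → vs (suc k)) (ℕ.suc-injective (trans (sym (ℕ.+-suc _ _)) total)))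
... | no _    | no _    | ≤n = contradiction (subst (ℕ._≤ n) total ≤n) (ℕ.<-irrefl refl)

H-gram : ∀ (R : Fin 8 → Lat) (h : Fin 6 → Fin 8) → IsOrthPosFamily R → (∀ k l → h k ≡ h l → k ≡ l) →
  ∀ k l → form (toQ (R (h k))) (toQ (R (h l))) ≡ 2ℚ * δ k l
H-gram R h (positive , orthogonal) h-injective k l with k ≟F l
... | yes refl = proj₁ (positive (h k))
... | no k≢l   = orthogonal (h k) (h l) (λ hk≡hl → k≢l (h-injective k l hk≡hl))

D6-sumSq-ht8≡1 : ∀ (R : Fin 8 → Lat) (h : Fin 6 → Fin 8) → IsOrthPosFamily R → (∀ k l → h k ≡ h l → k ≡ l) →
  count 6 (λ k → htIs (+ 1) (R (h k))) ≡ 2 → count 6 (λ k → htIs (+ 0) (R (h k))) ≡ 4 →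
  ∀ {e} → IsD6Ident (InXi R h) e → sumQ 6 (λ i → e i i8 * e i i8) ≡ 1ℚ
D6-sumSq-ht8≡1 R h orthPos h-injective count₁ count₀ {e} d6 = begin
  sumQ 6 (λ i → e i i8 * e i i8)                   ≡⟨ sumSq-coordinate-basis-change H e gram-H (proj₁ d6) H∈span-ε ε∈span-H i8 ⟩
  ½ * sumQ 6 (λ k → H k i8 * H k i8)               ≡⟨ cong (½ *_) (sumSq-ht8 6 (λ k → R (h k)) (cong₂ ℕ._+_ count₁ count₀)) ⟩
  ½ * fromℕ (count 6 (λ k → htIs (+ 1) (R (h k)))) ≡⟨ cong (λ n → ½ * fromℕ n) count₁ ⟩
  ½ * fromℕ 2                                      ≡⟨⟩
  1ℚ                                               ∎
  where
  open ≡-Reasoning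
  H : Fin 6 → VecQ
  H k = toQ (R (h k))
  gram-H : ∀ k l → form (H k) (H l) ≡ 2ℚ * δ k l
  gram-H = H-gram R h orthPos h-injective
  H∈span-ε : ∀ k → InSpan e (H k)
  H∈span-ε k = D6-root∈span-ε d6 (R (h k)) (proj₁ (proj₁ orthPos (h k)) , InSpan-member H k)
  ε∈span-H : ∀ i → InSpan H (e i)
  ε∈span-H = D6-ε∈span {vs = H} d6 (λ _ → proj₂)

-- Six natural numbers whose squares add up to 2

sumSq : List ℕ → ℕ
sumSq []       = 0
sumSq (n ∷ ns) = n ℕ.* n ℕ.+ sumSq ns

data Bit : ℕ → Set where
  bit₀ : Bit 0
  bit₁ : Bit 1

bit : ∀ {n} → n ℕ.* n ℕ.≤ 2 → Bit n
bit {0} _ = bit₀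
bit {1} _ = bit₁
bit {suc (suc n)} (s≤s (s≤s n²≤0)) with ℕ.m+n≤o⇒n≤o n n²≤0
... | ()

bits : ∀ ns → sumSq ns ℕ.≤ 2 → All Bit ns
bits []       _  = []
bits (n ∷ ns) ≤2 = bit (ℕ.≤-trans (ℕ.m≤m+n _ _) ≤2) ∷ bits ns (ℕ.≤-trans (ℕ.m≤n+m _ _) ≤2)

1≢double : ∀ q → 1 ≢ q ℕ.+ q
1≢double zero          ()
1≢double (suc zero)    ()
1≢double (suc (suc _)) ()

sumSq≡2-solution-bits : ∀ {a b c d e f p q} → Bit a → Bit b → Bit c → Bit d → Bit e → Bit f →
  sumSq (a ∷ b ∷ c ∷ d ∷ e ∷ f ∷ []) ≡ 2 →
  a ≡ c ℕ.+ (d ℕ.+ (b ℕ.+ (p ℕ.+ p))) → c ≡ e ℕ.+ (f ℕ.+ (d ℕ.+ (q ℕ.+ q))) →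
  a ≡ 1 × b ≡ 1 × c ≡ 0 × d ≡ 0 × e ≡ 0 × f ≡ 0
sumSq≡2-solution-bits bit₀ _    bit₁ _    _    _    _  () _
sumSq≡2-solution-bits bit₁ _    bit₁ bit₁ _    _    _  () _
sumSq≡2-solution-bits bit₁ bit₁ bit₁ bit₀ _    _    _  () _
sumSq≡2-solution-bits bit₁ bit₀ bit₁ bit₀ bit₁ bit₁ _  _  ()
sumSq≡2-solution-bits bit₁ bit₀ bit₁ bit₀ bit₁ bit₀ () _  _
sumSq≡2-solution-bits bit₁ bit₀ bit₁ bit₀ bit₀ bit₁ () _  _
-- The only case that needs parity; it would come from x = (½, ½, ½, ½, 0, 0).
sumSq≡2-solution-bits {q = q} bit₁ bit₀ bit₁ bit₀ bit₀ bit₀ _ _ 1≡2q = contradiction 1≡2q (1≢double q)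
sumSq≡2-solution-bits _    _    bit₀ _    bit₁ _    _  _  ()
sumSq≡2-solution-bits _    _    bit₀ _    bit₀ bit₁ _  _  ()
sumSq≡2-solution-bits _    _    bit₀ bit₁ bit₀ bit₀ _  _  ()
sumSq≡2-solution-bits bit₀ bit₀ bit₀ bit₀ bit₀ bit₀ () _  _
sumSq≡2-solution-bits bit₀ bit₁ bit₀ bit₀ bit₀ bit₀ () _  _
sumSq≡2-solution-bits bit₁ bit₀ bit₀ bit₀ bit₀ bit₀ () _  _
sumSq≡2-solution-bits bit₁ bit₁ bit₀ bit₀ bit₀ bit₀ _  _  _ = refl , refl , refl , refl , refl , refl

sumSq≡2-solution : ∀ {a b c d e f p q} → sumSq (a ∷ b ∷ c ∷ d ∷ e ∷ f ∷ []) ≡ 2 →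
  a ≡ c ℕ.+ (d ℕ.+ (b ℕ.+ (p ℕ.+ p))) → c ≡ e ℕ.+ (f ℕ.+ (d ℕ.+ (q ℕ.+ q))) →
  a ≡ 1 × b ≡ 1 × c ≡ 0 × d ≡ 0 × e ≡ 0 × f ≡ 0
sumSq≡2-solution {a} {b} {c} {d} {e} {f} {p} {q} sq
  with bits (a ∷ b ∷ c ∷ d ∷ e ∷ f ∷ []) (ℕ.≤-reflexive sq)
... | ba ∷ bb ∷ bc ∷ bd ∷ be ∷ bf ∷ [] = sumSq≡2-solution-bits {p = p} {q = q} ba bb bc bd be bf sq

-- Dominant weights of D₆ of norm one

sumSqℚ : List ℚ → ℚ
sumSqℚ = foldr (λ u r → u * u + r) 0ℚ

fromℕ-sumSq : ∀ ns → fromℕ (sumSq ns) ≡ sumSqℚ (map fromℕ ns)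
fromℕ-sumSq []       = refl
fromℕ-sumSq (n ∷ ns) =
  trans (fromℕ-homo-+ (n ℕ.* n) (sumSq ns)) (cong₂ _+_ (fromℕ-homo-* n n) (fromℕ-sumSq ns))

pair-squares : ∀ y₀ y₁ y₂ y₃ y₄ y₅ →
  sumSqℚ (y₀ ±[ true ] y₁ ∷ y₀ ±[ false ] y₁ ∷ y₂ ±[ true ] y₃ ∷ y₂ ±[ false ] y₃ ∷ y₄ ±[ true ] y₅ ∷ y₄ ±[ false ] y₅ ∷ [])
  ≡ 2ℚ * sumSqℚ (y₀ ∷ y₁ ∷ y₂ ∷ y₃ ∷ y₄ ∷ y₅ ∷ [])
pair-squares = solve 6 (λ y₀ y₁ y₂ y₃ y₄ y₅ →
    sq (y₀ ±ᴾ[ true ] y₁) :+ (sq (y₀ ±ᴾ[ false ] y₁) :+ (sq (y₂ ±ᴾ[ true ] y₃) :+ (sq (y₂ ±ᴾ[ false ] y₃) :+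
    (sq (y₄ ±ᴾ[ true ] y₅) :+ (sq (y₄ ±ᴾ[ false ] y₅) :+ con 0ℚ)))))
  := con 2ℚ :* (sq y₀ :+ (sq y₁ :+ (sq y₂ :+ (sq y₃ :+ (sq y₄ :+ (sq y₅ :+ con 0ℚ)))))))
  refl
  where
  sq : ∀ {n} → Polynomial n → Polynomial n
  sq u = u :* u

pair-heights-sumSq : ∀ (x : Fin 6 → ℚ) {a b c d e f} → sumQ 6 (λ i → x i * x i) ≡ 1ℚ →
  x (# 0) ±[ true ] x (# 1) ≡ fromℕ a → x (# 0) ±[ false ] x (# 1) ≡ fromℕ b →
  x (# 2) ±[ true ] x (# 3) ≡ fromℕ c → x (# 2) ±[ false ] x (# 3) ≡ fromℕ d →
  x (# 4) ±[ true ] x (# 5) ≡ fromℕ e → x (# 4) ±[ false ] x (# 5) ≡ fromℕ f →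
  sumSq (a ∷ b ∷ c ∷ d ∷ e ∷ f ∷ []) ≡ 2
pair-heights-sumSq x {a} {b} {c} {d} {e} {f} norm ha hb hc hd he hf = fromℕ-injective (begin
  fromℕ (sumSq (a ∷ b ∷ c ∷ d ∷ e ∷ f ∷ []))      ≡⟨ fromℕ-sumSq (a ∷ b ∷ c ∷ d ∷ e ∷ f ∷ []) ⟩
  sumSqℚ (map fromℕ (a ∷ b ∷ c ∷ d ∷ e ∷ f ∷ [])) ≡⟨ cong sumSqℚ heights ⟨
  sumSqℚ pair-heights                             ≡⟨ pair-squares (x (# 0)) (x (# 1)) (x (# 2)) (x (# 3)) (x (# 4)) (x (# 5)) ⟩
  2ℚ * sumQ 6 (λ i → x i * x i)                   ≡⟨ cong (2ℚ *_) norm ⟩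
  fromℕ 2                                         ∎)
  where
  open ≡-Reasoning
  pair-heights : List ℚ
  pair-heights = x (# 0) ±[ true ] x (# 1) ∷ x (# 0) ±[ false ] x (# 1) ∷ x (# 2) ±[ true ] x (# 3) ∷
                 x (# 2) ±[ false ] x (# 3) ∷ x (# 4) ±[ true ] x (# 5) ∷ x (# 4) ±[ false ] x (# 5) ∷ []
  heights : pair-heights ≡ map fromℕ (a ∷ b ∷ c ∷ d ∷ e ∷ f ∷ [])
  heights = cong₂ _∷_ ha (cong₂ _∷_ hb (cong₂ _∷_ hc (cong₂ _∷_ hd (cong₂ _∷_ he (cong₂ _∷_ hf refl)))))

-- In D₆: ε₁ + ε₂ = (ε₃ + ε₄) + (ε₃ − ε₄) + (ε₁ − ε₂) + 2 (ε₂ − ε₃).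
heights-relation : ∀ y₀ y₁ y₂ y₃ {a b c d p} →
  y₀ ±[ true ] y₁ ≡ fromℕ a → y₀ ±[ false ] y₁ ≡ fromℕ b →
  y₂ ±[ true ] y₃ ≡ fromℕ c → y₂ ±[ false ] y₃ ≡ fromℕ d →
  y₁ ±[ false ] y₂ ≡ fromℕ p → a ≡ c ℕ.+ (d ℕ.+ (b ℕ.+ (p ℕ.+ p)))
heights-relation y₀ y₁ y₂ y₃ {a} {b} {c} {d} {p} ha hb hc hd hp = fromℕ-injective (begin
  fromℕ a                                               ≡⟨ ha ⟨
  y₀ ±[ true ] y₁                                       ≡⟨ relation ⟩
  (y₂ ±[ true ] y₃) + ((y₂ ±[ false ] y₃) + ((y₀ ±[ false ] y₁) + ((y₁ ±[ false ] y₂) + (y₁ ±[ false ] y₂))))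
                                                        ≡⟨ cong₂ _+_ hc (cong₂ _+_ hd (cong₂ _+_ hb (cong₂ _+_ hp hp))) ⟩
  fromℕ c + (fromℕ d + (fromℕ b + (fromℕ p + fromℕ p))) ≡⟨ homo ⟨
  fromℕ (c ℕ.+ (d ℕ.+ (b ℕ.+ (p ℕ.+ p))))               ∎)
  where
  open ≡-Reasoning
  relation : y₀ ±[ true ] y₁ ≡
    (y₂ ±[ true ] y₃) + ((y₂ ±[ false ] y₃) + ((y₀ ±[ false ] y₁) + ((y₁ ±[ false ] y₂) + (y₁ ±[ false ] y₂))))
  relation = solve 4 (λ y₀ y₁ y₂ y₃ → y₀ ±ᴾ[ true ] y₁ :=
    (y₂ ±ᴾ[ true ] y₃) :+ ((y₂ ±ᴾ[ false ] y₃) :+ ((y₀ ±ᴾ[ false ] y₁) :+ ((y₁ ±ᴾ[ false ] y₂) :+ (y₁ ±ᴾ[ false ] y₂)))))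
    refl y₀ y₁ y₂ y₃
  homo : fromℕ (c ℕ.+ (d ℕ.+ (b ℕ.+ (p ℕ.+ p)))) ≡ fromℕ c + (fromℕ d + (fromℕ b + (fromℕ p + fromℕ p)))
  homo = trans (fromℕ-homo-+ c _) (cong (_+_ (fromℕ c)) (trans (fromℕ-homo-+ d _)
           (cong (_+_ (fromℕ d)) (trans (fromℕ-homo-+ b _) (cong (_+_ (fromℕ b)) (fromℕ-homo-+ p p))))))

pair-from-heights : ∀ y z {u v} → y ±[ true ] z ≡ u → y ±[ false ] z ≡ v →
  y ≡ ½ * u + ½ * v × z ≡ ½ * u + - ½ * v
pair-from-heights y z refl refl = pair-recover y z

pair-heights-ε₁ : ∀ (x : Fin 6 → ℚ) {a b c d e f} →
  x (# 0) ±[ true ] x (# 1) ≡ fromℕ a → x (# 0) ±[ false ] x (# 1) ≡ fromℕ b →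
  x (# 2) ±[ true ] x (# 3) ≡ fromℕ c → x (# 2) ±[ false ] x (# 3) ≡ fromℕ d →
  x (# 4) ±[ true ] x (# 5) ≡ fromℕ e → x (# 4) ±[ false ] x (# 5) ≡ fromℕ f →
  a ≡ 1 × b ≡ 1 × c ≡ 0 × d ≡ 0 × e ≡ 0 × f ≡ 0 → ∀ i → x i ≡ δ zero i
pair-heights-ε₁ x ha hb hc hd he hf (refl , refl , refl , refl , refl , refl) = λ where
  zero                               → proj₁ (pair-from-heights (x (# 0)) (x (# 1)) ha hb)
  (suc zero)                         → proj₂ (pair-from-heights (x (# 0)) (x (# 1)) ha hb)
  (suc (suc zero))                   → proj₁ (pair-from-heights (x (# 2)) (x (# 3)) hc hd)
  (suc (suc (suc zero)))             → proj₂ (pair-from-heights (x (# 2)) (x (# 3)) hc hd)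
  (suc (suc (suc (suc zero))))       → proj₁ (pair-from-heights (x (# 4)) (x (# 5)) he hf)
  (suc (suc (suc (suc (suc zero))))) → proj₂ (pair-from-heights (x (# 4)) (x (# 5)) he hf)

-- Indices are 0-based: x i is the height of εᵢ₊₁, and δ zero is ε₁.
norm-one-dominant-weight : ∀ (x : Fin 6 → ℚ) → sumQ 6 (λ i → x i * x i) ≡ 1ℚ →
  (∀ i j → i < j → ∀ t → Σ ℕ λ n → x i ±[ t ] x j ≡ fromℕ n) →
  ∀ i → x i ≡ δ zero i
norm-one-dominant-weight x norm natural
  with natural (# 0) (# 1) ℕ.≤-refl true  | natural (# 0) (# 1) ℕ.≤-refl false
     | natural (# 2) (# 3) ℕ.≤-refl true  | natural (# 2) (# 3) ℕ.≤-refl false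
     | natural (# 4) (# 5) ℕ.≤-refl true  | natural (# 4) (# 5) ℕ.≤-refl false
     | natural (# 1) (# 2) ℕ.≤-refl false | natural (# 3) (# 4) ℕ.≤-refl false
... | a , ha | b , hb | c , hc | d , hd | e , he | f , hf | p , hp | q , hq =
  pair-heights-ε₁ x ha hb hc hd he hf
    (sumSq≡2-solution {a} {b} {c} {d} {e} {f} {p} {q}
      (pair-heights-sumSq x norm ha hb hc hd he hf)
      (heights-relation (x (# 0)) (x (# 1)) (x (# 2)) (x (# 3)) ha hb hc hd hp)
      (heights-relation (x (# 2)) (x (# 3)) (x (# 4)) (x (# 5)) hc hd he hf hq))

ε₁-positive-heights : ∀ (x : Fin 6 → ℚ) → (∀ i → x i ≡ δ zero i) → ∀ i j → i < j → ∀ t →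
  (i ≡ zero → x i ±[ t ] x j ≡ 1ℚ) × (i ≢ zero → x i ±[ t ] x j ≡ 0ℚ)
ε₁-positive-heights x x≡ε₁ i j i<j t rewrite x≡ε₁ i | x≡ε₁ j = heights i j i<j t
  where
  heights : ∀ i j → i < j → ∀ t →
    (i ≡ zero → δ zero i ±[ t ] δ zero j ≡ 1ℚ) × (i ≢ zero → δ zero i ±[ t ] δ zero j ≡ 0ℚ)
  heights zero    (suc _) _ true  = (λ _ → refl) , (λ 0≢0 → contradiction refl 0≢0)
  heights zero    (suc _) _ false = (λ _ → refl) , (λ 0≢0 → contradiction refl 0≢0)
  heights (suc _) (suc _) _ true  = (λ ()) , (λ _ → refl)
  heights (suc _) (suc _) _ false = (λ ()) , (λ _ → refl)

ε₁-height≢2 : ∀ (x : Fin 6 → ℚ) → (∀ i → x i ≡ δ zero i) → ∀ i j → i < j → ∀ s t →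
  fromℕ 2 ≢ sgn s * x i + sgn t * x j
ε₁-height≢2 x x≡ε₁ i j i<j s t rewrite x≡ε₁ i | x≡ε₁ j = excluded i j i<j s t
  where
  excluded : ∀ i j → i < j → ∀ s t → fromℕ 2 ≢ sgn s * δ zero i + sgn t * δ zero j
  excluded zero    (suc _) _ true  true  ()
  excluded zero    (suc _) _ true  false ()
  excluded zero    (suc _) _ false true  ()
  excluded zero    (suc _) _ false false ()
  excluded (suc _) (suc _) _ true  true  ()
  excluded (suc _) (suc _) _ true  false ()
  excluded (suc _) (suc _) _ false true  ()
  excluded (suc _) (suc _) _ false false ()

lemma5p5 : (R : Fin 8 → Lat) → IsOrthPosFamily R → ThetaNotIn R →
    (h : Fin 6 → Fin 8) → InD6 R h →
    count 6 (λ k → htIs (+ 1) (R (h k))) ≡ 2 →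
    count 6 (λ k → htIs (+ 0) (R (h k))) ≡ 4 →
    (e : Fin 6 → VecQ) → IsPosD6Ident (InXi R h) e →
    ¬ InXi R h θ
    × ht8Q (comb e zero true (suc zero) true) ≡ 1ℚ
    × (ht8Q (comb e zero true (suc zero) false) ≡ 1ℚ
       × ht8Q (comb e (suc zero) true (suc (suc zero)) false) ≡ 0ℚ
       × ht8Q (comb e (suc (suc zero)) true (suc (suc (suc zero))) false) ≡ 0ℚ
       × ht8Q (comb e (suc (suc (suc zero))) true (suc (suc (suc (suc zero)))) false) ≡ 0ℚ
       × ht8Q (comb e (suc (suc (suc (suc zero)))) true (suc (suc (suc (suc (suc zero))))) false) ≡ 0ℚ
       × ht8Q (comb e (suc (suc (suc (suc zero)))) true (suc (suc (suc (suc (suc zero))))) true) ≡ 0ℚ)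
    × (∀ i j → i < j → ∀ t →
         (i ≡ zero → ht8Q (comb e i true j t) ≡ 1ℚ)
         × (i ≢ zero → ht8Q (comb e i true j t) ≡ 0ℚ))
lemma5p5 R orthPos _ h (h-injective , _) count₁ count₀ e ident@(d6 , _) =
  θ∉Ξ ,
  proj₁ (heights (# 0) (# 1) ℕ.≤-refl true) refl ,
  ( proj₁ (heights (# 0) (# 1) ℕ.≤-refl false) refl
  , proj₂ (heights (# 1) (# 2) ℕ.≤-refl false) (λ ())
  , proj₂ (heights (# 2) (# 3) ℕ.≤-refl false) (λ ())
  , proj₂ (heights (# 3) (# 4) ℕ.≤-refl false) (λ ())
  , proj₂ (heights (# 4) (# 5) ℕ.≤-refl false) (λ ())
  , proj₂ (heights (# 4) (# 5) ℕ.≤-refl true) (λ ())) ,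
  heights
  where
  x≡ε₁ : ∀ i → e i i8 ≡ δ zero i
  x≡ε₁ = norm-one-dominant-weight (λ i → e i i8) (D6-sumSq-ht8≡1 R h orthPos h-injective count₁ count₀ d6)
           (λ i j i<j t → D6-positive-coordinate-ℕ ident i j i<j t i8)
  heights : ∀ i j → i < j → ∀ t →
    (i ≡ zero → ht8Q (comb e i true j t) ≡ 1ℚ) × (i ≢ zero → ht8Q (comb e i true j t) ≡ 0ℚ)
  heights = ε₁-positive-heights (λ i → e i i8) x≡ε₁
  θ∉Ξ : ¬ InXi R h θ
  θ∉Ξ Ξθ with proj₂ (proj₂ d6) θ Ξθ
  ... | i , j , i<j , s , t , θ≈ = ε₁-height≢2 (λ i → e i i8) x≡ε₁ i j i<j s t (θ≈ i8)
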